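{- Let $m\ge 2$ be an integer and let $x_1,\dots,x_m$ be real numbers with $x_1\ge x_2\ge\cdots\ge x_m\ge 0$. Put $t=\sum_{i=1}^m x_i$. Then $$\sum_{1\le i<j\le m}x_ix_j^2\le \left(\frac{t}{2}\right)^3.$$ -}

module Defs where

open import Level using (Level; _⊔_) renaming (suc to lsuc)
open import Algebra.Bundles using (CommutativeRing)
open import Relation.Binary.Core using (Rel)
open import Relation.Binary.Structures using (IsTotalOrder)
open import Relation.Nullary using (¬_; does)
open import Data.Product using (∃)
open import Data.Nat using (ℕ; zero; suc)
open import Data.Fin using (Fin; _<?_)
import Data.Fin as Fin
open import Data.Bool using (if_then_else_)

-- An ordered field: a commutative ring with a total order compatible with
-- + and *, 0 ≠ 1, and multiplicative inverses of nonzero elements.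
-- The real numbers form such a structure.
record OrderedField (c ℓ₁ ℓ₂ : Level) : Set (lsuc (c ⊔ ℓ₁ ⊔ ℓ₂)) where
  field
    commutativeRing : CommutativeRing c ℓ₁
  open CommutativeRing commutativeRing public
  field
    _≤_          : Rel Carrier ℓ₂
    isTotalOrder : IsTotalOrder _≈_ _≤_
    +-mono-≤     : ∀ {x y} z → x ≤ y → (x + z) ≤ (y + z)
    *-nonneg     : ∀ {x y} → 0# ≤ x → 0# ≤ y → 0# ≤ (x * y)
    0≉1          : ¬ (0# ≈ 1#)
    inverse      : ∀ x → ¬ (x ≈ 0#) → ∃ λ y → (x * y) ≈ 1#

module Sums {c ℓ₁ ℓ₂} (F : OrderedField c ℓ₁ ℓ₂) where
  open OrderedField F

  Σ : ∀ {n} → (Fin n → Carrier) → Carrier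
  Σ {zero}  f = 0#
  Σ {suc n} f = f Fin.zero + Σ (λ i → f (Fin.suc i))

  Σ< : ∀ {n} → (Fin n → Fin n → Carrier) → Carrier
  Σ< f = Σ (λ i → Σ (λ j → if does (i <? j) then f i j else 0#))

-- Add the entries one at a time, from largest to smallest. With S = Σ_{i<j} x_i x_j² and
-- T = Σ x_i, appending an entry y changes S to S + T y² and T to T + y, and we show
-- 8 S ≤ T³ inductively. For two entries a ≥ b this is 8 a b² ≤ (a + b)³. From three
-- entries on, the new entry is at most each of the first two, so T ≥ 2y, and then
-- (T + y)³ − T³ − 8 T y² = y (3 T² − 5 T y + y²) ≥ 0 keeps the inequality alive.
module Submission where

open import Defs
open import Data.Nat using (ℕ)
import Data.Nat as ℕ
open import Data.Fin using (Fin; _≤_)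
open import Relation.Binary.PropositionalEquality using (_≡_)

import Data.Nat.Properties as ℕ
open import Data.Fin using (zero; suc; toℕ; inject₁; fromℕ; _<?_)
open import Data.Fin.Properties using (toℕ-inject₁; toℕ-fromℕ; toℕ<n; ≤fromℕ)
open import Data.Vec.Functional using (init; last)
open import Data.Bool using (true; false; if_then_else_)
open import Data.Sum using (inj₁; inj₂)
open import Function using (_∘_)
open import Relation.Nullary using (does)
open import Relation.Nullary.Decidable using (dec-true; dec-false)
open import Relation.Binary.Bundles using (Poset)
open import Relation.Binary.Structures using (IsTotalOrder)
import Relation.Binary.PropositionalEquality as ≡

does-<?-cong : ∀ {m m′ n n′} {i : Fin m} {i′ : Fin m′} {j : Fin n} {j′ : Fin n′} →
               toℕ i ≡ toℕ i′ → toℕ j ≡ toℕ j′ → does (i <? j) ≡ does (i′ <? j′)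
does-<?-cong = ≡.cong₂ (λ a b → does (ℕ.suc a ℕ.≤? b))

does-inject₁<?inject₁ : ∀ {n} (i j : Fin n) → does (inject₁ i <? inject₁ j) ≡ does (i <? j)
does-inject₁<?inject₁ i j = does-<?-cong (toℕ-inject₁ i) (toℕ-inject₁ j)

does-inject₁<?fromℕ : ∀ {n} (i : Fin n) → does (inject₁ i <? fromℕ n) ≡ true
does-inject₁<?fromℕ {n} i =
  dec-true (inject₁ i <? fromℕ n) (≡.subst₂ ℕ._<_ (≡.sym (toℕ-inject₁ i)) (≡.sym (toℕ-fromℕ n)) (toℕ<n i))

does-fromℕ<? : ∀ {n} (j : Fin (ℕ.suc n)) → does (fromℕ n <? j) ≡ false
does-fromℕ<? {n} j = dec-false (fromℕ n <? j) (ℕ.≤⇒≯ (≤fromℕ j))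

inject₁-mono-≤ : ∀ {n} {i j : Fin n} → i ≤ j → inject₁ i ≤ inject₁ j
inject₁-mono-≤ {i = i} {j} = ≡.subst₂ ℕ._≤_ (≡.sym (toℕ-inject₁ i)) (≡.sym (toℕ-inject₁ j))

module _ {c ℓ₁ ℓ₂} (F : OrderedField c ℓ₁ ℓ₂) where
  open OrderedField F hiding (zero) renaming (_≤_ to infix 4 _≤F_; +-mono-≤ to +-monoˡ-≤)
  open Sums F
  open IsTotalOrder isTotalOrder using (total; isPartialOrder; ≤-respʳ-≈) renaming (refl to ≤-refl; trans to ≤-trans)
  open import Algebra.Properties.Ring ring using (-‿distribˡ-*; -‿distribʳ-*; -‿involutive)
  open import Algebra.Properties.Semiring.Mult semiring using (_×_; ×-congʳ)
  open import Algebra.Properties.Semiring.Exp semiring using (_^_; ^-congˡ)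
  open import Algebra.Properties.CommutativeSemigroup +-commutativeSemigroup using (interchange)
  open import Algebra.Properties.Monoid.Sum +-monoid using (sum; sum-cong-≋; sum-init-last; sum-replicate-zero)
  open import Algebra.Properties.Semiring.Sum semiring using (*-distribʳ-sum)
  open import Algebra.Solver.Ring.NaturalCoefficients.Default commutativeSemiring

  poset : Poset c ℓ₁ ℓ₂
  poset = record { isPartialOrder = isPartialOrder }

  open import Relation.Binary.Reasoning.PartialOrder poset

  +-monoʳ-≤ : ∀ z {x y} → x ≤F y → z + x ≤F z + y
  +-monoʳ-≤ z {x} {y} x≤y = begin
    z + x  ≈⟨ +-comm z x ⟩
    x + z  ≤⟨ +-monoˡ-≤ z x≤y ⟩
    y + z  ≈⟨ +-comm y z ⟩
    z + y  ∎

  +-mono-≤ : ∀ {x y u v} → x ≤F y → u ≤F v → x + u ≤F y + v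
  +-mono-≤ {x} {y} {u} {v} x≤y u≤v = begin
    x + u  ≤⟨ +-monoˡ-≤ u x≤y ⟩
    y + u  ≤⟨ +-monoʳ-≤ y u≤v ⟩
    y + v  ∎

  x≤x+y : ∀ {x y} → 0# ≤F y → x ≤F x + y
  x≤x+y {x} {y} 0≤y = begin
    x      ≈⟨ +-identityʳ x ⟨
    x + 0# ≤⟨ +-monoʳ-≤ x 0≤y ⟩
    x + y  ∎

  +-nonneg : ∀ {x y} → 0# ≤F x → 0# ≤F y → 0# ≤F x + y
  +-nonneg {x} {y} 0≤x 0≤y = begin
    0#     ≤⟨ 0≤x ⟩
    x      ≤⟨ x≤x+y 0≤y ⟩
    x + y  ∎

  ×-nonneg : ∀ n {x} → 0# ≤F x → 0# ≤F n × x
  ×-nonneg ℕ.zero    0≤x = ≤-refl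
  ×-nonneg (ℕ.suc n) 0≤x = +-nonneg 0≤x (×-nonneg n 0≤x)

  x≤y⇒0≤y-x : ∀ {x y} → x ≤F y → 0# ≤F y - x
  x≤y⇒0≤y-x {x} {y} x≤y = begin
    0#     ≈⟨ -‿inverseʳ x ⟨
    x - x  ≤⟨ +-monoˡ-≤ (- x) x≤y ⟩
    y - x  ∎

  x+[y-x]≈y : ∀ x y → x + (y - x) ≈ y
  x+[y-x]≈y x y = begin-equality
    x + (y - x)   ≈⟨ +-congˡ (+-comm y (- x)) ⟩
    x + (- x + y) ≈⟨ +-assoc x (- x) y ⟨
    (x - x) + y   ≈⟨ +-congʳ (-‿inverseʳ x) ⟩
    0# + y        ≈⟨ +-identityˡ y ⟩
    y             ∎

  *-monoˡ-≤-nonneg : ∀ {z} → 0# ≤F z → ∀ {x y} → x ≤F y → x * z ≤F y * z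
  *-monoˡ-≤-nonneg {z} 0≤z {x} {y} x≤y = begin
    x * z                 ≤⟨ x≤x+y (*-nonneg (x≤y⇒0≤y-x x≤y) 0≤z) ⟩
    x * z + (y - x) * z   ≈⟨ distribʳ z x (y - x) ⟨
    (x + (y - x)) * z     ≈⟨ *-congʳ (x+[y-x]≈y x y) ⟩
    y * z                 ∎

  x*x-nonneg : ∀ x → 0# ≤F x * x
  x*x-nonneg x with total 0# x
  ... | inj₁ 0≤x = *-nonneg 0≤x 0≤x
  ... | inj₂ x≤0 = begin
    0#            ≤⟨ *-nonneg 0≤-x 0≤-x ⟩
    - x * - x     ≈⟨ -‿distribˡ-* x (- x) ⟨
    - (x * - x)   ≈⟨ -‿cong (-‿distribʳ-* x x) ⟨
    - - (x * x)   ≈⟨ -‿involutive (x * x) ⟩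
    x * x         ∎
    where
    0≤-x : 0# ≤F - x
    0≤-x = ≤-respʳ-≈ (+-identityˡ (- x)) (x≤y⇒0≤y-x x≤0)

  half-nonneg : ∀ {h} → (1# + 1#) * h ≈ 1# → 0# ≤F h
  half-nonneg {h} 2h≈1 = begin
    0#                   ≤⟨ +-nonneg (x*x-nonneg h) (x*x-nonneg h) ⟩
    h * h + h * h        ≈⟨ solve 1 (λ h → h :* h :+ h :* h := ((con 1 :+ con 1) :* h) :* h) refl h ⟩
    ((1# + 1#) * h) * h  ≈⟨ *-congʳ 2h≈1 ⟩
    1# * h               ≈⟨ *-identityˡ h ⟩
    h                    ∎

  Σ≡sum : ∀ {n} (f : Fin n → Carrier) → Σ f ≡ sum f
  Σ≡sum {ℕ.zero}  f = ≡.refl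
  Σ≡sum {ℕ.suc n} f = ≡.cong (f zero +_) (Σ≡sum (f ∘ suc))

  Σ-cong : ∀ {n} {f g : Fin n → Carrier} → (∀ i → f i ≈ g i) → Σ f ≈ Σ g
  Σ-cong {f = f} {g} f≈g rewrite Σ≡sum f | Σ≡sum g = sum-cong-≋ f≈g

  Σ-init-last : ∀ {n} (f : Fin (ℕ.suc n) → Carrier) → Σ f ≈ Σ (init f) + last f
  Σ-init-last f rewrite Σ≡sum f | Σ≡sum (init f) = sum-init-last f

  Σ-zero : ∀ {n} {f : Fin n → Carrier} → (∀ i → f i ≈ 0#) → Σ f ≈ 0#
  Σ-zero {n} {f} f≈0 rewrite Σ≡sum f = trans (sum-cong-≋ f≈0) (sum-replicate-zero n)

  *-distribʳ-Σ : ∀ {n} x (f : Fin n → Carrier) → Σ f * x ≈ Σ (λ i → f i * x)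
  *-distribʳ-Σ x f rewrite Σ≡sum f | Σ≡sum (λ i → f i * x) = *-distribʳ-sum x f

  Σ-distrib-+ : ∀ {n} (f g : Fin n → Carrier) → Σ (λ i → f i + g i) ≈ Σ f + Σ g
  Σ-distrib-+ {ℕ.zero}  f g = sym (+-identityʳ 0#)
  Σ-distrib-+ {ℕ.suc n} f g = begin-equality
    (f zero + g zero) + Σ (λ i → f (suc i) + g (suc i))  ≈⟨ +-congˡ (Σ-distrib-+ (f ∘ suc) (g ∘ suc)) ⟩
    (f zero + g zero) + (Σ (f ∘ suc) + Σ (g ∘ suc))     ≈⟨ interchange _ _ _ _ ⟩
    (f zero + Σ (f ∘ suc)) + (g zero + Σ (g ∘ suc))     ∎

  Σ-nonneg : ∀ {n} {f : Fin n → Carrier} → (∀ i → 0# ≤F f i) → 0# ≤F Σ f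
  Σ-nonneg {ℕ.zero}  0≤f = ≤-refl
  Σ-nonneg {ℕ.suc n} 0≤f = +-nonneg (0≤f zero) (Σ-nonneg (0≤f ∘ suc))

  if-cong : ∀ {b b′} x → b ≡ b′ → (if b then x else 0#) ≈ (if b′ then x else 0#)
  if-cong x = reflexive ∘ ≡.cong (λ b → if b then x else 0#)

  Σ<-init-last : ∀ {n} (f : Fin (ℕ.suc n) → Fin (ℕ.suc n) → Carrier) →
                 Σ< f ≈ Σ< (λ i j → f (inject₁ i) (inject₁ j)) + Σ (λ i → f (inject₁ i) (fromℕ n))
  Σ<-init-last {n} f = begin-equality
    Σ< f                                                        ≈⟨ Σ-init-last (row f) ⟩
    Σ (λ i → row f (inject₁ i)) + row f (fromℕ n)               ≈⟨ +-cong (Σ-cong row-inject₁) row-fromℕ ⟩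
    Σ (λ i → row f′ i + f (inject₁ i) (fromℕ n)) + 0#           ≈⟨ +-identityʳ _ ⟩
    Σ (λ i → row f′ i + f (inject₁ i) (fromℕ n))                ≈⟨ Σ-distrib-+ (row f′) _ ⟩
    Σ< f′ + Σ (λ i → f (inject₁ i) (fromℕ n))                   ∎
    where
    row : ∀ {k} → (Fin k → Fin k → Carrier) → Fin k → Carrier
    row g i = Σ (λ j → if does (i <? j) then g i j else 0#)
    f′ : Fin n → Fin n → Carrier
    f′ i j = f (inject₁ i) (inject₁ j)
    row-inject₁ : ∀ i → row f (inject₁ i) ≈ row f′ i + f (inject₁ i) (fromℕ n)
    row-inject₁ i =
      trans (Σ-init-last (λ j → if does (inject₁ i <? j) then f (inject₁ i) j else 0#))
      (+-cong (Σ-cong (λ j → if-cong (f′ i j) (does-inject₁<?inject₁ i j)))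
              (if-cong (f (inject₁ i) (fromℕ n)) (does-inject₁<?fromℕ i)))
    row-fromℕ : row f (fromℕ n) ≈ 0#
    row-fromℕ = Σ-zero (λ j → if-cong (f (fromℕ n) j) (does-fromℕ<? j))

  -- The only summand is guarded by 0 < 0, which evaluates to false.
  Σ<-singleton : (f : Fin 1 → Fin 1 → Carrier) → Σ< f ≈ 0#
  Σ<-singleton f = trans (+-identityʳ _) (+-identityʳ 0#)

  8ab²≤[a+b]³ : ∀ {a b} → 0# ≤F b → b ≤F a → 8 × (a * (b * b)) ≤F (a + b) ^ 3
  8ab²≤[a+b]³ {a} {b} 0≤b b≤a = begin
    8 × (a * (b * b))                                                   ≈⟨ ×-congʳ 8 (*-congʳ a≈b+d) ⟩
    8 × ((b + d) * (b * b))                                             ≤⟨ x≤x+y (*-nonneg 0≤d 0≤q) ⟩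
    8 × ((b + d) * (b * b)) + d * (4 × (b * b) + 6 × (b * d) + d * d)  ≈⟨ expand b d ⟩
    ((b + d) + b) ^ 3                                                   ≈⟨ ^-congˡ 3 (+-congʳ a≈b+d) ⟨
    (a + b) ^ 3                                                         ∎
    where
    d : Carrier
    d = a - b
    a≈b+d : a ≈ b + d
    a≈b+d = sym (x+[y-x]≈y b a)
    0≤d : 0# ≤F d
    0≤d = x≤y⇒0≤y-x b≤a
    0≤q : 0# ≤F 4 × (b * b) + 6 × (b * d) + d * d
    0≤q = +-nonneg (+-nonneg (×-nonneg 4 (x*x-nonneg b)) (×-nonneg 6 (*-nonneg 0≤b 0≤d))) (x*x-nonneg d)
    expand : ∀ b d → 8 × ((b + d) * (b * b)) + d * (4 × (b * b) + 6 × (b * d) + d * d) ≈ ((b + d) + b) ^ 3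
    expand = solve 2 (λ b d → 8 :× ((b :+ d) :* (b :* b)) :+ d :* (4 :× (b :* b) :+ 6 :× (b :* d) :+ d :* d)
                            := ((b :+ d) :+ b) :^ 3) refl

  -- t ≥ 2y gives 3t²y ≥ 6ty², which with the remaining 3ty² + y³ covers the added 8ty².
  cube-step : ∀ {s t y} → 0# ≤F y → 2 × y ≤F t → 8 × s ≤F t ^ 3 →
              8 × (s + t * (y * y)) ≤F (t + y) ^ 3
  cube-step {s} {t} {y} 0≤y 2y≤t 8s≤t³ = begin
    8 × (s + t * (y * y))                                              ≈⟨ 8×-distrib s t y ⟩
    8 × s + 8 × (t * (y * y))                                          ≤⟨ +-monoˡ-≤ _ 8s≤t³ ⟩
    t ^ 3 + 8 × (t * (y * y))                                          ≤⟨ x≤x+y 0≤r ⟩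
    t ^ 3 + 8 × (t * (y * y)) + (t * (y * y) + y * (y * y))            ≈⟨ regroup t y ⟩
    t ^ 3 + 2 × y * (3 × (t * y)) + 3 × (t * (y * y)) + y * (y * y)    ≤⟨ +-monoˡ-≤ _ (+-monoˡ-≤ _ (+-monoʳ-≤ _ 2y·3ty≤t·3ty)) ⟩
    t ^ 3 + t * (3 × (t * y)) + 3 × (t * (y * y)) + y * (y * y)        ≈⟨ expand t y ⟩
    (t + y) ^ 3                                                        ∎
    where
    0≤t : 0# ≤F t
    0≤t = ≤-trans (×-nonneg 2 0≤y) 2y≤t
    0≤r : 0# ≤F t * (y * y) + y * (y * y)
    0≤r = +-nonneg (*-nonneg 0≤t (x*x-nonneg y)) (*-nonneg 0≤y (x*x-nonneg y))
    2y·3ty≤t·3ty : 2 × y * (3 × (t * y)) ≤F t * (3 × (t * y))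
    2y·3ty≤t·3ty = *-monoˡ-≤-nonneg (×-nonneg 3 (*-nonneg 0≤t 0≤y)) 2y≤t
    8×-distrib : ∀ s t y → 8 × (s + t * (y * y)) ≈ 8 × s + 8 × (t * (y * y))
    8×-distrib = solve 3 (λ s t y → 8 :× (s :+ t :* (y :* y)) := 8 :× s :+ 8 :× (t :* (y :* y))) refl
    regroup : ∀ t y → t ^ 3 + 8 × (t * (y * y)) + (t * (y * y) + y * (y * y))
                      ≈ t ^ 3 + 2 × y * (3 × (t * y)) + 3 × (t * (y * y)) + y * (y * y)
    regroup = solve 2 (λ t y → t :^ 3 :+ 8 :× (t :* (y :* y)) :+ (t :* (y :* y) :+ y :* (y :* y))
                            := t :^ 3 :+ 2 :× y :* (3 :× (t :* y)) :+ 3 :× (t :* (y :* y)) :+ y :* (y :* y)) refl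
    expand : ∀ t y → t ^ 3 + t * (3 × (t * y)) + 3 × (t * (y * y)) + y * (y * y) ≈ (t + y) ^ 3
    expand = solve 2 (λ t y → t :^ 3 :+ t :* (3 :× (t :* y)) :+ 3 :× (t :* (y :* y)) :+ y :* (y :* y)
                            := (t :+ y) :^ 3) refl

  Antitone : ∀ {n} → (Fin n → Carrier) → Set ℓ₂
  Antitone x = ∀ i j → i ≤ j → x j ≤F x i

  NonNegative : ∀ {n} → (Fin n → Carrier) → Set ℓ₂
  NonNegative x = ∀ i → 0# ≤F x i

  Antitone-init : ∀ {n} {x : Fin (ℕ.suc n) → Carrier} → Antitone x → Antitone (init x)
  Antitone-init x↓ i j i≤j = x↓ (inject₁ i) (inject₁ j) (inject₁-mono-≤ i≤j)

  2×last≤Σinit : ∀ {n} (x : Fin (3 ℕ.+ n) → Carrier) → Antitone x → NonNegative x →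
                 2 × last x ≤F Σ (init x)
  2×last≤Σinit x x↓ 0≤x =
    +-mono-≤ (x↓ zero _ ℕ.z≤n)
      (+-mono-≤ (x↓ (suc zero) _ (ℕ.s≤s ℕ.z≤n)) (Σ-nonneg (λ i → 0≤x (suc (suc (inject₁ i))))))

  Σ<xy² : ∀ {n} → (Fin n → Carrier) → Carrier
  Σ<xy² x = Σ< (λ i j → x i * (x j * x j))

  Σ<xy²-init-last : ∀ {n} (x : Fin (ℕ.suc n) → Carrier) →
                    Σ<xy² x ≈ Σ<xy² (init x) + Σ (init x) * (last x * last x)
  Σ<xy²-init-last x =
    trans (Σ<-init-last (λ i j → x i * (x j * x j))) (+-congˡ (sym (*-distribʳ-Σ _ (init x))))

  8Σ<xy²≤[Σx]³ : ∀ n (x : Fin (2 ℕ.+ n) → Carrier) → Antitone x → NonNegative x →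
                 8 × Σ<xy² x ≤F Σ x ^ 3
  8Σ<xy²≤[Σx]³-init-last : ∀ n (x : Fin (2 ℕ.+ n) → Carrier) → Antitone x → NonNegative x →
                 8 × (Σ<xy² (init x) + Σ (init x) * (last x * last x)) ≤F (Σ (init x) + last x) ^ 3

  8Σ<xy²≤[Σx]³ n x x↓ 0≤x = begin
    8 × Σ<xy² x                                                ≈⟨ ×-congʳ 8 (Σ<xy²-init-last x) ⟩
    8 × (Σ<xy² (init x) + Σ (init x) * (last x * last x))      ≤⟨ 8Σ<xy²≤[Σx]³-init-last n x x↓ 0≤x ⟩
    (Σ (init x) + last x) ^ 3                                  ≈⟨ ^-congˡ 3 (Σ-init-last x) ⟨
    Σ x ^ 3                                                    ∎

  8Σ<xy²≤[Σx]³-init-last ℕ.zero x x↓ 0≤x = begin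
    8 × (Σ<xy² (init x) + Σ (init x) * (last x * last x))
      ≈⟨ ×-congʳ 8 (trans (+-congʳ Σ<xy²[init]≈0) (+-identityˡ _)) ⟩
    8 × (Σ (init x) * (last x * last x))                   ≤⟨ 8ab²≤[a+b]³ (0≤x _) last≤Σinit ⟩
    (Σ (init x) + last x) ^ 3                              ∎
    where
    Σ<xy²[init]≈0 : Σ<xy² (init x) ≈ 0#
    Σ<xy²[init]≈0 = Σ<-singleton (λ i j → init x i * (init x j * init x j))
    last≤Σinit : last x ≤F x zero + 0#
    last≤Σinit = ≤-respʳ-≈ (sym (+-identityʳ _)) (x↓ zero _ ℕ.z≤n)
  8Σ<xy²≤[Σx]³-init-last (ℕ.suc n) x x↓ 0≤x =
    cube-step (0≤x _) (2×last≤Σinit x x↓ 0≤x)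
      (8Σ<xy²≤[Σx]³ n (init x) (Antitone-init x↓) (0≤x ∘ inject₁))

  8s≤t³⇒s≤[th]³ : ∀ {s t h} → (1# + 1#) * h ≈ 1# → 8 × s ≤F t ^ 3 →
                  s ≤F ((t * h) * (t * h)) * (t * h)
  8s≤t³⇒s≤[th]³ {s} {t} {h} 2h≈1 8s≤t³ = begin
    s                              ≈⟨ s≈8s·h³ ⟩
    8 × s * ((h * h) * h)          ≤⟨ *-monoˡ-≤-nonneg 0≤h³ 8s≤t³ ⟩
    t ^ 3 * ((h * h) * h)          ≈⟨ t³h³≈[th]³ t h ⟩
    ((t * h) * (t * h)) * (t * h)  ∎
    where
    2h : Carrier
    2h = (1# + 1#) * h
    s≈8s·h³ : s ≈ 8 × s * ((h * h) * h)
    s≈8s·h³ = begin-equality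
      s                       ≈⟨ solve 1 (λ s → s := s :* ((con 1 :* con 1) :* con 1)) refl s ⟩
      s * ((1# * 1#) * 1#)    ≈⟨ *-congˡ (*-cong (*-cong 2h≈1 2h≈1) 2h≈1) ⟨
      s * ((2h * 2h) * 2h)    ≈⟨ solve 2 (λ s h → s :* ((((con 1 :+ con 1) :* h) :* ((con 1 :+ con 1) :* h))
                                                    :* ((con 1 :+ con 1) :* h))
                                             := 8 :× s :* ((h :* h) :* h)) refl s h ⟩
      8 × s * ((h * h) * h)   ∎
    0≤h³ : 0# ≤F (h * h) * h
    0≤h³ = *-nonneg (x*x-nonneg h) (half-nonneg 2h≈1)
    t³h³≈[th]³ : ∀ t h → t ^ 3 * ((h * h) * h) ≈ ((t * h) * (t * h)) * (t * h)
    t³h³≈[th]³ = solve 2 (λ t h → t :^ 3 :* ((h :* h) :* h) := ((t :* h) :* (t :* h)) :* (t :* h)) refl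

lemma6 : ∀ {c ℓ₁ ℓ₂} (F : OrderedField c ℓ₁ ℓ₂) →
         let open OrderedField F renaming (_≤_ to _≤F_) in
         let open Sums F in
         (m : ℕ) → 2 ℕ.≤ m → (x : Fin m → Carrier) →
         (∀ i j → i ≤ j → x j ≤F x i) →
         (∀ i → 0# ≤F x i) →
         (h : Carrier) → ((1# + 1#) * h) ≈ 1# →
         Σ< (λ i j → x i * (x j * x j)) ≤F (((Σ x * h) * (Σ x * h)) * (Σ x * h))
lemma6 F (ℕ.suc (ℕ.suc n)) (ℕ.s≤s (ℕ.s≤s ℕ.z≤n)) x x↓ 0≤x h 2h≈1 =
  8s≤t³⇒s≤[th]³ F 2h≈1 (8Σ<xy²≤[Σx]³ F n x x↓ 0≤x)
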